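{- For $n\ge1$, the Laplacian simplex $T_{K_n}$ of the complete graph $K_n$ is reflexive.
   Context: For a connected graph $G$ on vertex set $[n]$, its Laplacian $L$ has $L_{ii}=\deg(i)$, $L_{ij}=-1$ if $\{i,j\}$ is an edge and $0$ otherwise. Let $A$ be the $n\times(n-1)$ matrix with $a_{ij}=1$ if $i\le j\le n-1$ and $0$ otherwise, and $L_B=LA$. The Laplacian simplex $T_G\subseteq\mathbb{R}^{n-1}$ is the convex hull of the rows of $L_B$. A full-dimensional lattice polytope $P$ is reflexive if it contains the origin in its interior and its dual $P^*=\{x:x\cdot y\le1\ \forall y\in P\}$ is a lattice polytope.
   Formalization: The points of the simplex $T_{K_n}$ and of its dual, including those near the origin, are taken in ℚ^(n−1) rather than $\mathbb{R}^{n-1}$, with rational convex weights. -}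

module Defs where

open import Data.Nat using (ℕ; zero; suc)
open import Data.Fin using (Fin; zero; suc; toℕ)
open import Data.Bool using (Bool; true; false; not)
open import Data.Product using (Σ; _×_; _,_)
open import Function.Bundles using (_⇔_)
open import Relation.Nullary.Decidable using (⌊_⌋)
import Data.Nat as ℕ
import Data.Fin as Fin
import Data.Integer as ℤ
open import Data.Integer using (ℤ)
open import Data.Rational using (ℚ; 0ℚ; 1ℚ; _+_; _*_; _≤_; _<_; ∣_∣)
import Data.Rational as ℚ

sumℤ : ∀ {k} → (Fin k → ℤ) → ℤ
sumℤ {zero}  f = ℤ.+ 0
sumℤ {suc k} f = f zero ℤ.+ sumℤ (λ i → f (suc i))

sumℚ : ∀ {k} → (Fin k → ℚ) → ℚ
sumℚ {zero}  f = 0ℚ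
sumℚ {suc k} f = f zero + sumℚ (λ i → f (suc i))

-- Graphs on vertex set Fin n (given by a Boolean adjacency function;
-- simple graphs are symmetric and irreflexive) and their Laplacians.

Graph : ℕ → Set
Graph n = Fin n → Fin n → Bool

b2ℤ : Bool → ℤ
b2ℤ true  = ℤ.+ 1
b2ℤ false = ℤ.+ 0

degree : ∀ {n} → Graph n → Fin n → ℤ
degree G i = sumℤ (λ j → b2ℤ (G i j))

laplacian : ∀ {n} → Graph n → Fin n → Fin n → ℤ
laplacian G i j with ⌊ i Fin.≟ j ⌋
... | true  = degree G i
... | false = ℤ.- b2ℤ (G i j)

complete : (n : ℕ) → Graph n
complete n i j = not ⌊ i Fin.≟ j ⌋

-- A : n × (n-1) matrix, a_ij = 1 iff i ≤ j (same with 0-based indices);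
-- here n = suc m.
matA : (m : ℕ) → Fin (suc m) → Fin m → ℤ
matA m i j with ⌊ toℕ i ℕ.≤? toℕ j ⌋
... | true  = ℤ.+ 1
... | false = ℤ.+ 0

-- L_B = L A ; row i of L_B is the i-th vertex of T_G ⊆ ℚ^m
LB : ∀ {m} → Graph (suc m) → Fin (suc m) → Fin m → ℤ
LB {m} G i j = sumℤ (λ k → laplacian G i k ℤ.* matA m k j)

Point : ℕ → Set
Point d = Fin d → ℚ

toℚ : ℤ → ℚ
toℚ z = z ℚ./ 1

latticeToPoint : ∀ {d} → (Fin d → ℤ) → Point d
latticeToPoint v c = toℚ (v c)

dot : ∀ {d} → Point d → Point d → ℚ
dot x y = sumℚ (λ c → x c * y c)

InConv : ∀ {k d} → (Fin k → Point d) → Point d → Set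
InConv {k} {d} V x =
  Σ (Fin k → ℚ) λ t →
    (∀ i → 0ℚ ≤ t i) × (sumℚ t ≡ 1ℚ) × (∀ c → sumℚ (λ i → t i * V i c) ≡ x c)
  where open import Relation.Binary.PropositionalEquality using (_≡_)

IsLatticePolytope : ∀ {d} → (Point d → Set) → Set
IsLatticePolytope {d} S =
  Σ ℕ λ k → Σ (Fin k → Fin d → ℤ) λ W →
    ∀ x → S x ⇔ InConv (λ i → latticeToPoint (W i)) x

InDual : ∀ {k d} → (Fin k → Point d) → Point d → Set
InDual V y = ∀ x → InConv V x → dot x y ≤ 1ℚ

OriginInInterior : ∀ {k d} → (Fin k → Point d) → Set
OriginInInterior V =
  Σ ℚ λ ε → (0ℚ < ε) × (∀ x → (∀ c → ∣ x c ∣ ≤ ε) → InConv V x)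

IsReflexive : ∀ {k d} → (Fin k → Fin d → ℤ) → Set
IsReflexive V =
  OriginInInterior (λ i → latticeToPoint (V i)) ×
  IsLatticePolytope (InDual (λ i → latticeToPoint (V i)))

laplacianSimplexVertices : ∀ {m} → Graph (suc m) → Fin (suc m) → Fin m → ℤ
laplacianSimplexVertices G = LB G

-- Write n = m + 1.  The vertices of T_{K_n} are the rows of L·A with
-- L = n·I − J, i.e. Vᵢ = n·(Σ_{c ≥ i} e_c) − Σ_c (c + 1)·e_c in ℚ^m, and
-- we pair them with the lattice points W_k = e_{k−1} − e_k (e_{−1} = e_m = 0).
-- Both families sum to zero, ⟨Vᵢ, W_k⟩ = 1 − n·[i = k] and
-- Σ_k V_k W_kᵀ = −n·I; we call such families dual simplices.
--
-- For dual simplices, ⟨W_k, x⟩ ≤ 1 for all k puts x in conv V, with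
-- barycentric coordinates (1 − ⟨W_k, x⟩)/n, and symmetrically; since the
-- dual of conv V is cut out by the inequalities ⟨Vᵢ, ·⟩ ≤ 1, it equals
-- conv W.  Reflexivity follows: the cube
-- |x_c| ≤ ½ satisfies ⟨W_k, x⟩ = x_{k−1} − x_k ≤ 1 and so lies in T_{K_n},
-- and the dual of T_{K_n} is the lattice simplex conv W.

module Submission where

open import Defs
open import Data.Nat using (ℕ; zero; suc; z≤n; s≤s)
import Data.Nat as ℕ
import Data.Nat.Properties as ℕP
open import Data.Fin using (Fin; zero; suc; toℕ)
import Data.Fin as Fin
import Data.Fin.Properties as FinP
open import Data.Integer using (ℤ; -[1+_])
import Data.Integer as ℤ
import Data.Integer.Properties as ℤP
open import Data.Rational using (ℚ; 0ℚ; 1ℚ; ½; _+_; _*_; _-_; -_; _≤_; ∣_∣; mkℚ; 1/_; Positive)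
import Data.Rational as ℚ
import Data.Rational.Properties as ℚP
open import Data.Rational.Solver using (module +-*-Solver)
import Data.Nat.Coprimality as Coprimality
open import Data.Product using (_,_)
open import Data.Empty using (⊥-elim)
open import Function using (_∘_)
open import Function.Bundles using (_⇔_; mk⇔; Equivalence)
open import Relation.Nullary using (yes; no; ¬_)
open import Relation.Binary.PropositionalEquality
open import Algebra.Bundles using (Ring)
import Algebra.Properties.Semiring.Sum as SemiringSum
open +-*-Solver using (solve; _:+_; _:*_; _:-_; :-_; _:=_; con)

over1 : ∀ z → Coprimality.Coprime ℤ.∣ z ∣ 1
over1 z = Coprimality.sym (Coprimality.1-coprimeTo _)

toℚ-as-mkℚ : ∀ z → toℚ z ≡ mkℚ z 0 (over1 z)
toℚ-as-mkℚ z = ℚP.↥p/↧p≡p (mkℚ z 0 (over1 z))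

toℚ-+ : ∀ a b → toℚ (a ℤ.+ b) ≡ toℚ a + toℚ b
toℚ-+ a b = begin
  toℚ (a ℤ.+ b)                      ≡⟨ cong toℚ (sym (cong₂ ℤ._+_ (ℤP.*-identityʳ a) (ℤP.*-identityʳ b))) ⟩
  toℚ (a ℤ.* ℤ.+ 1 ℤ.+ b ℤ.* ℤ.+ 1)  ≡⟨ sym (cong₂ _+_ (toℚ-as-mkℚ a) (toℚ-as-mkℚ b)) ⟩
  toℚ a + toℚ b                      ∎
  where open ≡-Reasoning

toℚ-* : ∀ a b → toℚ (a ℤ.* b) ≡ toℚ a * toℚ b
toℚ-* a b = sym (cong₂ _*_ (toℚ-as-mkℚ a) (toℚ-as-mkℚ b))

toℚ-neg : ∀ a → toℚ (ℤ.- a) ≡ - toℚ a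
toℚ-neg a = trans (toℚ-as-mkℚ (ℤ.- a)) (sym (trans (cong -_ (toℚ-as-mkℚ a)) (neg-mkℚ a)))
  where
  neg-mkℚ : ∀ z → - mkℚ z 0 (over1 z) ≡ mkℚ (ℤ.- z) 0 (over1 (ℤ.- z))
  neg-mkℚ (ℤ.+ zero)  = refl
  neg-mkℚ (ℤ.+ suc n) = refl
  neg-mkℚ -[1+ n ]    = refl

toℚ-sum : ∀ {k} (f : Fin k → ℤ) → toℚ (sumℤ f) ≡ sumℚ (λ i → toℚ (f i))
toℚ-sum {zero}  f = refl
toℚ-sum {suc k} f = trans (toℚ-+ (f zero) _) (cong (toℚ (f zero) +_) (toℚ-sum (f ∘ suc)))

module Σℚ = SemiringSum (Ring.semiring ℚP.+-*-ring)

sumℚ≡∑ : ∀ {k} (f : Fin k → ℚ) → sumℚ f ≡ Σℚ.sum f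
sumℚ≡∑ {zero}  f = refl
sumℚ≡∑ {suc k} f = cong (f zero +_) (sumℚ≡∑ (f ∘ suc))

sum-cong : ∀ {k} {f g : Fin k → ℚ} → (∀ i → f i ≡ g i) → sumℚ f ≡ sumℚ g
sum-cong {f = f} {g} f≗g =
  trans (sumℚ≡∑ f) (trans (Σℚ.sum-cong-≗ f≗g) (sym (sumℚ≡∑ g)))

sum-+ : ∀ {k} (f g : Fin k → ℚ) → sumℚ (λ i → f i + g i) ≡ sumℚ f + sumℚ g
sum-+ f g = trans (sumℚ≡∑ (λ i → f i + g i))
  (trans (Σℚ.∑-distrib-+ f g) (sym (cong₂ _+_ (sumℚ≡∑ f) (sumℚ≡∑ g))))

sum-*ˡ : ∀ {k} (a : ℚ) (f : Fin k → ℚ) → sumℚ (λ i → a * f i) ≡ a * sumℚ f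
sum-*ˡ a f = trans (sumℚ≡∑ (λ i → a * f i))
  (trans (sym (Σℚ.*-distribˡ-sum a f)) (cong (a *_) (sym (sumℚ≡∑ f))))

sum-swap : ∀ {k l} (f : Fin k → Fin l → ℚ) →
  sumℚ (λ i → sumℚ (λ j → f i j)) ≡ sumℚ (λ j → sumℚ (λ i → f i j))
sum-swap f = begin
  sumℚ (λ i → sumℚ (f i))             ≡⟨ sum-cong (λ i → sumℚ≡∑ (f i)) ⟩
  sumℚ (λ i → Σℚ.sum (f i))           ≡⟨ sumℚ≡∑ (λ i → Σℚ.sum (f i)) ⟩
  Σℚ.sum (λ i → Σℚ.sum (f i))         ≡⟨ Σℚ.∑-comm f ⟩
  Σℚ.sum (λ j → Σℚ.sum (λ i → f i j)) ≡⟨ sym (sumℚ≡∑ (λ j → Σℚ.sum (λ i → f i j))) ⟩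
  sumℚ (λ j → Σℚ.sum (λ i → f i j))   ≡⟨ sum-cong (λ j → sym (sumℚ≡∑ (λ i → f i j))) ⟩
  sumℚ (λ j → sumℚ (λ i → f i j))     ∎
  where open ≡-Reasoning

sum-neg : ∀ {k} (f : Fin k → ℚ) → sumℚ (λ i → - f i) ≡ - sumℚ f
sum-neg {zero}  f = refl
sum-neg {suc k} f =
  trans (cong (- f zero +_) (sum-neg (f ∘ suc))) (sym (ℚP.neg-distrib-+ (f zero) (sumℚ (f ∘ suc))))

sum-- : ∀ {k} (f g : Fin k → ℚ) → sumℚ (λ i → f i - g i) ≡ sumℚ f - sumℚ g
sum-- f g = trans (sum-+ f (λ i → - g i)) (cong (sumℚ f +_) (sum-neg g))

sum-mono : ∀ {k} {f g : Fin k → ℚ} → (∀ i → f i ≤ g i) → sumℚ f ≤ sumℚ g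
sum-mono {zero}  f≤g = ℚP.≤-refl
sum-mono {suc k} f≤g = ℚP.+-mono-≤ (f≤g zero) (sum-mono (f≤g ∘ suc))

sum-const : ∀ k (a : ℚ) → sumℚ {k} (λ _ → a) ≡ toℚ (ℤ.+ k) * a
sum-const zero    a = sym (ℚP.*-zeroˡ a)
sum-const (suc k) a = begin
  a + sumℚ {k} (λ _ → a)            ≡⟨ cong (a +_) (sum-const k a) ⟩
  a + toℚ (ℤ.+ k) * a               ≡⟨ cong (_+ toℚ (ℤ.+ k) * a) (sym (ℚP.*-identityˡ a)) ⟩
  1ℚ * a + toℚ (ℤ.+ k) * a          ≡⟨ sym (ℚP.*-distribʳ-+ a 1ℚ (toℚ (ℤ.+ k))) ⟩
  (1ℚ + toℚ (ℤ.+ k)) * a            ≡⟨ cong (_* a) (sym (toℚ-+ (ℤ.+ 1) (ℤ.+ k))) ⟩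
  toℚ (ℤ.+ suc k) * a               ∎
  where open ≡-Reasoning

sum-zero : ∀ k → sumℚ {k} (λ _ → 0ℚ) ≡ 0ℚ
sum-zero k = trans (sum-const k 0ℚ) (ℚP.*-zeroʳ (toℚ (ℤ.+ k)))

sum-*ʳ : ∀ {k} (f : Fin k → ℚ) (a : ℚ) → sumℚ f * a ≡ sumℚ (λ i → f i * a)
sum-*ʳ f a = trans (cong (_* a) (sumℚ≡∑ f))
  (trans (Σℚ.*-distribʳ-sum a f) (sym (sumℚ≡∑ (λ i → f i * a))))

-- Indicators on ℕ: the Kronecker delta δ a b = [a = b] and
-- indLe a b = [a ≤ b], as rationals.  δ is the image of an integer
-- delta, so that vectors built from it are lattice points.

δℤ : ℕ → ℕ → ℤ
δℤ zero    zero    = ℤ.+ 1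
δℤ zero    (suc b) = ℤ.+ 0
δℤ (suc a) zero    = ℤ.+ 0
δℤ (suc a) (suc b) = δℤ a b

δ : ℕ → ℕ → ℚ
δ a b = toℚ (δℤ a b)

indLe : ℕ → ℕ → ℚ
indLe zero    b       = 1ℚ
indLe (suc a) zero    = 0ℚ
indLe (suc a) (suc b) = indLe a b

δ-sym : ∀ a b → δ a b ≡ δ b a
δ-sym zero    zero    = refl
δ-sym zero    (suc b) = refl
δ-sym (suc a) zero    = refl
δ-sym (suc a) (suc b) = δ-sym a b

δ-diag : ∀ a → δ a a ≡ 1ℚ
δ-diag zero    = refl
δ-diag (suc a) = δ-diag a

δ-off-diag : ∀ {a b} → a ≢ b → δ a b ≡ 0ℚ
δ-off-diag {zero}  {zero}  a≢b = ⊥-elim (a≢b refl)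
δ-off-diag {zero}  {suc b} a≢b = refl
δ-off-diag {suc a} {zero}  a≢b = refl
δ-off-diag {suc a} {suc b} a≢b = δ-off-diag (a≢b ∘ cong suc)

δ-nonneg : ∀ a b → 0ℚ ≤ δ a b
δ-nonneg zero    zero    = ℚP.nonNegative⁻¹ 1ℚ
δ-nonneg zero    (suc b) = ℚP.≤-refl
δ-nonneg (suc a) zero    = ℚP.≤-refl
δ-nonneg (suc a) (suc b) = δ-nonneg a b

indLe-split : ∀ a b → indLe a b ≡ δ a b + indLe (suc a) b
indLe-split zero    zero    = refl
indLe-split zero    (suc b) = refl
indLe-split (suc a) zero    = refl
indLe-split (suc a) (suc b) = indLe-split a b

indLe-yes : ∀ {a b} → a ℕ.≤ b → indLe a b ≡ 1ℚ
indLe-yes {zero}          _       = refl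
indLe-yes {suc a} {suc b} (s≤s p) = indLe-yes p

indLe-no : ∀ {a b} → ¬ a ℕ.≤ b → indLe a b ≡ 0ℚ
indLe-no {zero}          ¬p = ⊥-elim (¬p z≤n)
indLe-no {suc a} {zero}  ¬p = refl
indLe-no {suc a} {suc b} ¬p = indLe-no (¬p ∘ s≤s)

count-indLe : ∀ k c → c ℕ.< k → sumℚ {k} (λ j → indLe (toℕ j) c) ≡ toℚ (ℤ.+ suc c)
count-indLe (suc k) zero    _       = trans (cong (1ℚ +_) (sum-zero k)) (ℚP.+-identityʳ 1ℚ)
count-indLe (suc k) (suc c) (s≤s p) = trans (cong (1ℚ +_) (count-indLe k c p))
                                            (sym (toℚ-+ (ℤ.+ 1) (ℤ.+ suc c)))

entryAt : ∀ {k} → (Fin k → ℚ) → ℕ → ℚ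
entryAt {zero}  y a       = 0ℚ
entryAt {suc k} y zero    = y zero
entryAt {suc k} y (suc a) = entryAt (y ∘ suc) a

padded : ∀ {k} → (Fin k → ℚ) → ℕ → ℚ
padded y zero    = 0ℚ
padded y (suc a) = entryAt y a

entryAt-toℕ : ∀ {k} (y : Fin k → ℚ) (j : Fin k) → entryAt y (toℕ j) ≡ y j
entryAt-toℕ y zero    = refl
entryAt-toℕ y (suc j) = entryAt-toℕ (y ∘ suc) j

entryAt-beyond : ∀ k (y : Fin k → ℚ) → entryAt y k ≡ 0ℚ
entryAt-beyond zero    y = refl
entryAt-beyond (suc k) y = entryAt-beyond k (y ∘ suc)

entryAt-formula : ∀ {k} (y : Fin k → ℚ) (g : ℕ → ℚ) → (∀ c → y c ≡ g (toℕ c)) →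
                  ∀ {a} → a ℕ.< k → entryAt y a ≡ g a
entryAt-formula {suc k} y g y≗g {zero}  _       = y≗g zero
entryAt-formula {suc k} y g y≗g {suc a} (s≤s p) =
  entryAt-formula (y ∘ suc) (g ∘ suc) (y≗g ∘ suc) p

padded-formula : ∀ {k} (y : Fin k → ℚ) (g : ℕ → ℚ) → (∀ c → y c ≡ g (suc (toℕ c))) →
                 g 0 ≡ 0ℚ → g (suc k) ≡ 0ℚ → ∀ {a} → a ℕ.≤ suc k → padded y a ≡ g a
padded-formula y g y≗g g0 gk {zero}  _ = sym g0
padded-formula {k} y g y≗g g0 gk {suc a} (s≤s a≤k) with a ℕ.<? k
... | yes a<k = entryAt-formula y (g ∘ suc) y≗g a<k
... | no  a≮k rewrite ℕP.≤-antisym a≤k (ℕP.≮⇒≥ a≮k) = trans (entryAt-beyond k y) (sym gk)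

entryAt-bound : ∀ {k} (y : Fin k → ℚ) {b} → 0ℚ ≤ b → (∀ c → ∣ y c ∣ ≤ b) →
                ∀ a → ∣ entryAt y a ∣ ≤ b
entryAt-bound {zero}  y 0≤b _   a       = 0≤b
entryAt-bound {suc k} y 0≤b y≤b zero    = y≤b zero
entryAt-bound {suc k} y 0≤b y≤b (suc a) = entryAt-bound (y ∘ suc) 0≤b (y≤b ∘ suc) a

padded-bound : ∀ {k} (y : Fin k → ℚ) {b} → 0ℚ ≤ b → (∀ c → ∣ y c ∣ ≤ b) →
               ∀ a → ∣ padded y a ∣ ≤ b
padded-bound y 0≤b y≤b zero    = 0≤b
padded-bound y 0≤b y≤b (suc a) = entryAt-bound y 0≤b y≤b a

sum-zero-weights : ∀ {k} (y : Fin k → ℚ) → sumℚ (λ c → 0ℚ * y c) ≡ 0ℚ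
sum-zero-weights {k} y = trans (sum-cong (λ c → ℚP.*-zeroˡ (y c))) (sum-zero k)

sum-δ : ∀ {k} a (y : Fin k → ℚ) → sumℚ (λ c → δ a (toℕ c) * y c) ≡ entryAt y a
sum-δ {zero}  a       y = refl
sum-δ {suc k} zero    y =
  trans (cong₂ _+_ (ℚP.*-identityˡ (y zero)) (sum-zero-weights (y ∘ suc))) (ℚP.+-identityʳ _)
sum-δ {suc k} (suc a) y =
  trans (cong₂ _+_ (ℚP.*-zeroˡ (y zero)) (sum-δ a (y ∘ suc))) (ℚP.+-identityˡ _)

sum-δ-at : ∀ {k} (j : Fin k) (y : Fin k → ℚ) → sumℚ (λ c → δ (toℕ j) (toℕ c) * y c) ≡ y j
sum-δ-at j y = trans (sum-δ (toℕ j) y) (entryAt-toℕ y j)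

sum-scaled-δ : ∀ {k} (j : Fin k) (a : ℚ) (y : Fin k → ℚ) →
               sumℚ (λ c → - (a * δ (toℕ j) (toℕ c)) * y c) ≡ - (a * y j)
sum-scaled-δ j a y = begin
  sumℚ (λ c → - (a * δ (toℕ j) (toℕ c)) * y c)     ≡⟨ sum-cong (λ c → regroup (δ (toℕ j) (toℕ c)) (y c)) ⟩
  sumℚ (λ c → - (a * (δ (toℕ j) (toℕ c) * y c)))   ≡⟨ sum-neg (λ c → a * (δ (toℕ j) (toℕ c) * y c)) ⟩
  - sumℚ (λ c → a * (δ (toℕ j) (toℕ c) * y c))     ≡⟨ cong -_ (sum-*ˡ a (λ c → δ (toℕ j) (toℕ c) * y c)) ⟩
  - (a * sumℚ (λ c → δ (toℕ j) (toℕ c) * y c))     ≡⟨ cong (λ z → - (a * z)) (sum-δ-at j y) ⟩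
  - (a * y j)                                      ∎
  where
  open ≡-Reasoning
  regroup : ∀ e v → - (a * e) * v ≡ - (a * (e * v))
  regroup e v = solve 3 (λ a e v → (:- (a :* e)) :* v := :- (a :* (e :* v))) refl a e v

sum-δ-shift : ∀ {k} a (y : Fin k → ℚ) → sumℚ (λ c → δ a (suc (toℕ c)) * y c) ≡ padded y a
sum-δ-shift zero    y = sum-zero-weights y
sum-δ-shift (suc a) y = sum-δ a y

count-δ : ∀ k {a} → a ℕ.< k → sumℚ {k} (λ j → δ a (toℕ j)) ≡ 1ℚ
count-δ k {a} a<k = begin
  sumℚ {k} (λ j → δ a (toℕ j))       ≡⟨ sum-cong {k} (λ j → sym (ℚP.*-identityʳ (δ a (toℕ j)))) ⟩
  sumℚ {k} (λ j → δ a (toℕ j) * 1ℚ)  ≡⟨ sum-δ {k} a (λ _ → 1ℚ) ⟩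
  entryAt {k} (λ _ → 1ℚ) a           ≡⟨ entryAt-formula (λ _ → 1ℚ) (λ _ → 1ℚ) (λ _ → refl) a<k ⟩
  1ℚ                                 ∎
  where open ≡-Reasoning

combo : ∀ {k d} → (Fin k → ℚ) → (Fin k → Point d) → Point d
combo t P c = sumℚ (λ i → t i * P i c)

dot-comm : ∀ {d} (x y : Point d) → dot x y ≡ dot y x
dot-comm x y = sum-cong (λ c → ℚP.*-comm (x c) (y c))

dot-congˡ : ∀ {d} {x x′ : Point d} (y : Point d) → (∀ c → x c ≡ x′ c) → dot x y ≡ dot x′ y
dot-congˡ y x≗x′ = sum-cong (λ c → cong (_* y c) (x≗x′ c))

dot-combo : ∀ {k d} (t : Fin k → ℚ) (P : Fin k → Point d) (z : Point d) →
            dot (combo t P) z ≡ sumℚ (λ i → t i * dot (P i) z)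
dot-combo t P z = begin
  sumℚ (λ c → combo t P c * z c)                 ≡⟨ sum-cong (λ c → sum-*ʳ (λ i → t i * P i c) (z c)) ⟩
  sumℚ (λ c → sumℚ (λ i → t i * P i c * z c))    ≡⟨ sum-swap (λ c i → t i * P i c * z c) ⟩
  sumℚ (λ i → sumℚ (λ c → t i * P i c * z c))    ≡⟨ sum-cong (λ i → trans
                                                       (sum-cong (λ c → ℚP.*-assoc (t i) (P i c) (z c)))
                                                       (sum-*ˡ (t i) (λ c → P i c * z c))) ⟩
  sumℚ (λ i → t i * dot (P i) z)                 ∎
  where open ≡-Reasoning

nonneg-* : ∀ {a b} → 0ℚ ≤ a → 0ℚ ≤ b → 0ℚ ≤ a * b
nonneg-* {a} {b} 0≤a 0≤b = ℚP.nonNegative⁻¹ (a * b)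
  {{ℚP.nonNeg*nonNeg⇒nonNeg a {{ℚ.nonNegative 0≤a}} b {{ℚ.nonNegative 0≤b}}}}

hull-from-weights : ∀ {k d} (V : Fin k → Point d) (x : Point d) (a : Fin k → ℚ)
                    (N : ℚ) {{_ : Positive N}} → (∀ i → 0ℚ ≤ a i) → sumℚ a ≡ N →
                    (∀ c → combo a V c ≡ N * x c) → InConv V x
hull-from-weights V x a N a≥0 Σa≡N combo≡Nx = t , t≥0 , Σt≡1 , combo≡x
  where
  instance
    N≢0 : ℚ.NonZero N
    N≢0 = ℚP.pos⇒nonZero N
  t : _ → ℚ
  t i = 1/ N * a i
  t≥0 : ∀ i → 0ℚ ≤ t i
  t≥0 i = nonneg-* (ℚP.nonNegative⁻¹ (1/ N) {{ℚP.pos⇒nonNeg (1/ N) {{ℚP.1/pos⇒pos N}}}}) (a≥0 i)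
  Σt≡1 : sumℚ t ≡ 1ℚ
  Σt≡1 = trans (sum-*ˡ (1/ N) a) (trans (cong (1/ N *_) Σa≡N) (ℚP.*-inverseˡ N))
  combo≡x : ∀ c → combo t V c ≡ x c
  combo≡x c = begin
    sumℚ (λ i → 1/ N * a i * V i c)    ≡⟨ sum-cong (λ i → ℚP.*-assoc (1/ N) (a i) (V i c)) ⟩
    sumℚ (λ i → 1/ N * (a i * V i c))  ≡⟨ sum-*ˡ (1/ N) (λ i → a i * V i c) ⟩
    1/ N * combo a V c                 ≡⟨ cong (1/ N *_) (combo≡Nx c) ⟩
    1/ N * (N * x c)                   ≡⟨ sym (ℚP.*-assoc (1/ N) N (x c)) ⟩
    1/ N * N * x c                     ≡⟨ cong (_* x c) (ℚP.*-inverseˡ N) ⟩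
    1ℚ * x c                           ≡⟨ ℚP.*-identityˡ (x c) ⟩
    x c                                ∎
    where open ≡-Reasoning

vertex-in-hull : ∀ {k d} (V : Fin k → Point d) (j : Fin k) → InConv V (V j)
vertex-in-hull {k} V j =
  (λ i → δ (toℕ j) (toℕ i)) , (λ i → δ-nonneg (toℕ j) (toℕ i)) ,
  count-δ k (FinP.toℕ<n j) , (λ c → sum-δ-at j (λ i → V i c))

hull-below : ∀ {k d} (V : Fin k → Point d) {y x : Point d} →
             (∀ i → dot (V i) y ≤ 1ℚ) → InConv V x → dot x y ≤ 1ℚ
hull-below V {y} {x} Vy≤1 (t , t≥0 , Σt≡1 , combo≡x) = begin
  dot x y                            ≡⟨ dot-congˡ y (λ c → sym (combo≡x c)) ⟩
  dot (combo t V) y                  ≡⟨ dot-combo t V y ⟩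
  sumℚ (λ i → t i * dot (V i) y)     ≤⟨ sum-mono (λ i → ℚP.*-monoˡ-≤-nonNeg (t i) {{ℚ.nonNegative (t≥0 i)}} (Vy≤1 i)) ⟩
  sumℚ (λ i → t i * 1ℚ)              ≡⟨ sum-cong (λ i → ℚP.*-identityʳ (t i)) ⟩
  sumℚ t                             ≡⟨ Σt≡1 ⟩
  1ℚ                                 ∎
  where open ℚP.≤-Reasoning

dual-by-vertices : ∀ {k d} (V : Fin k → Point d) (y : Point d) →
                   InDual V y ⇔ (∀ i → dot (V i) y ≤ 1ℚ)
dual-by-vertices V y = mk⇔ (λ y∈V* i → y∈V* (V i) (vertex-in-hull V i))
                           (λ Vy≤1 x x∈V → hull-below V Vy≤1 x∈V)

sum-dot-centred : ∀ {k d} (P : Fin k → Point d) (z : Point d) →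
                  (∀ c → sumℚ (λ i → P i c) ≡ 0ℚ) → sumℚ (λ i → dot (P i) z) ≡ 0ℚ
sum-dot-centred P z ΣP≡0 = begin
  sumℚ (λ i → dot (P i) z)           ≡⟨ sum-cong (λ i → sym (ℚP.*-identityˡ (dot (P i) z))) ⟩
  sumℚ (λ i → 1ℚ * dot (P i) z)      ≡⟨ sym (dot-combo (λ _ → 1ℚ) P z) ⟩
  dot (combo (λ _ → 1ℚ) P) z         ≡⟨ dot-congˡ z (λ c → trans (sum-cong (λ i → ℚP.*-identityˡ (P i c))) (ΣP≡0 c)) ⟩
  sumℚ (λ c → 0ℚ * z c)              ≡⟨ sum-zero-weights z ⟩
  0ℚ                                 ∎
  where open ≡-Reasoning

N : ℕ → ℚ
N m = toℚ (ℤ.+ suc m)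

N-pos : ∀ m → Positive (N m)
N-pos m = ℚP.normalize-pos (suc m) 1

record DualSimplices (m : ℕ) (V W : Fin (suc m) → Point m) : Set where
  field
    V-centred  : ∀ c → sumℚ (λ k → V k c) ≡ 0ℚ
    W-centred  : ∀ c → sumℚ (λ k → W k c) ≡ 0ℚ
    pairing    : ∀ i k → dot (V i) (W k) ≡ 1ℚ - N m * δ (toℕ i) (toℕ k)
    resolution : ∀ c d → combo (λ k → V k c) W d ≡ - (N m * δ (toℕ c) (toℕ d))

swap : ∀ {m V W} → DualSimplices m V W → DualSimplices m W V
swap {m} {V} {W} F = record
  { V-centred  = W-centred
  ; W-centred  = V-centred
  ; pairing    = λ i k → trans (dot-comm (W i) (V k))
                   (trans (pairing k i) (cong (λ e → 1ℚ - N m * e) (δ-sym (toℕ k) (toℕ i))))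
  ; resolution = λ c d → trans (sum-cong (λ k → ℚP.*-comm (W k c) (V k d)))
                   (trans (resolution d c) (cong (λ e → - (N m * e)) (δ-sym (toℕ d) (toℕ c))))
  }
  where open DualSimplices F

0≤-of-≤ : ∀ {p q} → p ≤ q → 0ℚ ≤ q - p
0≤-of-≤ {p} {q} p≤q =
  subst (_≤ q - p) (ℚP.+-inverseʳ p) (ℚP.+-mono-≤ p≤q (ℚP.≤-refl { - p}))

in-hull : ∀ {m V W} → DualSimplices m V W → (x : Point m) →
          (∀ k → dot (W k) x ≤ 1ℚ) → InConv V x
in-hull {m} {V} {W} F x Wx≤1 =
  hull-from-weights V x slack (N m) {{N-pos m}} (λ k → 0≤-of-≤ (Wx≤1 k)) total weighted
  where
  open DualSimplices F
  slack : Fin (suc m) → ℚ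
  slack k = 1ℚ - dot (W k) x
  total : sumℚ slack ≡ N m
  total = begin
    sumℚ slack                                          ≡⟨ sum-- (λ _ → 1ℚ) (λ k → dot (W k) x) ⟩
    sumℚ {suc m} (λ _ → 1ℚ) - sumℚ (λ k → dot (W k) x)  ≡⟨ cong₂ _-_ (sum-const (suc m) 1ℚ)
                                                                     (sum-dot-centred W x W-centred) ⟩
    N m * 1ℚ - 0ℚ                                       ≡⟨ solve 1 (λ n → n :* con 1ℚ :- con 0ℚ := n) refl (N m) ⟩
    N m                                                 ∎
    where open ≡-Reasoning
  -- Σ_k (1 − ⟨W_k, x⟩) V_k = Σ_k V_k − (Σ_k V_k W_kᵀ) x = 0 + N·x
  weighted : ∀ c → combo slack V c ≡ N m * x c
  weighted c = begin
    sumℚ (λ k → (1ℚ - dot (W k) x) * V k c)             ≡⟨ sum-cong (λ k → expand (dot (W k) x) (V k c)) ⟩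
    sumℚ (λ k → V k c - V k c * dot (W k) x)            ≡⟨ sum-- (λ k → V k c) (λ k → V k c * dot (W k) x) ⟩
    sumℚ (λ k → V k c) - sumℚ (λ k → V k c * dot (W k) x)
                                                        ≡⟨ cong₂ _-_ (V-centred c) (sym (dot-combo (λ k → V k c) W x)) ⟩
    0ℚ - dot (combo (λ k → V k c) W) x                  ≡⟨ cong (λ z → 0ℚ - z) (dot-congˡ x (resolution c)) ⟩
    0ℚ - sumℚ (λ d → - (N m * δ (toℕ c) (toℕ d)) * x d) ≡⟨ cong (λ z → 0ℚ - z) (sum-scaled-δ c (N m) x) ⟩
    0ℚ - - (N m * x c)                                  ≡⟨ solve 1 (λ a → con 0ℚ :- (:- a) := a) refl (N m * x c) ⟩
    N m * x c                                           ∎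
    where
    open ≡-Reasoning
    expand : ∀ w v → (1ℚ - w) * v ≡ v - v * w
    expand = solve 2 (λ w v → (con 1ℚ :- w) :* v := v :- v :* w) refl

sub-nonneg-≤ : ∀ {p q} → 0ℚ ≤ q → p - q ≤ p
sub-nonneg-≤ {p} {q} 0≤q =
  subst (p - q ≤_) (ℚP.+-identityʳ p) (ℚP.+-mono-≤ (ℚP.≤-refl {p}) (ℚP.neg-antimono-≤ 0≤q))

-- Points of conv W satisfy the inequalities ⟨Vᵢ, ·⟩ ≤ 1: if y = Σ s_k W_k
-- then ⟨Vᵢ, y⟩ = Σ_k s_k (1 − N·[i = k]) = 1 − N·sᵢ.
hull-pairing : ∀ {m V W} → DualSimplices m V W → {y : Point m} → InConv W y →
               ∀ i → dot (V i) y ≤ 1ℚ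
hull-pairing {m} {V} {W} F {y} (s , s≥0 , Σs≡1 , combo≡y) i =
  subst (_≤ 1ℚ) (sym Vᵢy) (sub-nonneg-≤ (nonneg-* (ℚP.<⇒≤ (ℚP.positive⁻¹ (N m) {{N-pos m}})) (s≥0 i)))
  where
  open DualSimplices F
  open ≡-Reasoning
  Vᵢy : dot (V i) y ≡ 1ℚ - N m * s i
  Vᵢy = begin
    dot (V i) y                                         ≡⟨ dot-comm (V i) y ⟩
    dot y (V i)                                         ≡⟨ dot-congˡ (V i) (λ c → sym (combo≡y c)) ⟩
    dot (combo s W) (V i)                               ≡⟨ dot-combo s W (V i) ⟩
    sumℚ (λ k → s k * dot (W k) (V i))                  ≡⟨ sum-cong (λ k → cong (s k *_) (trans (dot-comm (W k) (V i))
                                                                                                (pairing i k))) ⟩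
    sumℚ (λ k → s k * (1ℚ - N m * δᵢ k))                ≡⟨ sum-cong (λ k → expand (s k) (N m) (δᵢ k)) ⟩
    sumℚ (λ k → s k - N m * (δᵢ k * s k))               ≡⟨ sum-- s (λ k → N m * (δᵢ k * s k)) ⟩
    sumℚ s - sumℚ (λ k → N m * (δᵢ k * s k))            ≡⟨ cong₂ _-_ Σs≡1 (sum-*ˡ (N m) (λ k → δᵢ k * s k)) ⟩
    1ℚ - N m * sumℚ (λ k → δᵢ k * s k)                  ≡⟨ cong (λ z → 1ℚ - N m * z) (sum-δ-at i s) ⟩
    1ℚ - N m * s i                                      ∎
    where
    δᵢ : Fin (suc m) → ℚ
    δᵢ k = δ (toℕ i) (toℕ k)
    expand : ∀ a n e → a * (1ℚ - n * e) ≡ a - n * (e * a)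
    expand = solve 3 (λ a n e → a :* (con 1ℚ :- n :* e) := a :- n :* (e :* a)) refl

dual-is-hull : ∀ {m V W} → DualSimplices m V W → ∀ y → InDual V y ⇔ InConv W y
dual-is-hull {V = V} F y = mk⇔
  (λ y∈V* → in-hull (swap F) y (Equivalence.to (dual-by-vertices V y) y∈V*))
  (λ y∈W → Equivalence.from (dual-by-vertices V y) (hull-pairing F y∈W))

-- The Laplacian simplex of the complete graph K_{m+1}.  Its vertices
-- are Vᵢ = N·(Σ_{c ≥ i} e_c) − Σ_c (c + 1) e_c, and the dual vertices
-- are W_k = e_{k−1} − e_k (with e_{−1} = e_m = 0).

V : ∀ m → Fin (suc m) → Point m
V m i = latticeToPoint (laplacianSimplexVertices (complete (suc m)) i)

Wℤ : ∀ m → Fin (suc m) → Fin m → ℤ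
Wℤ m k c = δℤ (toℕ k) (suc (toℕ c)) ℤ.- δℤ (toℕ k) (toℕ c)

W : ∀ m → Fin (suc m) → Point m
W m k = latticeToPoint (Wℤ m k)

complete-edge : ∀ {n} (i j : Fin n) → toℚ (b2ℤ (complete n i j)) ≡ 1ℚ - δ (toℕ i) (toℕ j)
complete-edge i j with i Fin.≟ j
... | yes refl = sym (trans (cong (λ e → 1ℚ - e) (δ-diag (toℕ i))) (ℚP.+-inverseʳ 1ℚ))
... | no  i≢j  = sym (trans (cong (λ e → 1ℚ - e) (δ-off-diag (i≢j ∘ FinP.toℕ-injective)))
                            (ℚP.+-identityʳ 1ℚ))

complete-degree : ∀ m (i : Fin (suc m)) → toℚ (degree (complete (suc m)) i) ≡ N m - 1ℚ
complete-degree m i = begin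
  toℚ (degree (complete (suc m)) i)                         ≡⟨ toℚ-sum (λ j → b2ℤ (complete (suc m) i j)) ⟩
  sumℚ (λ j → toℚ (b2ℤ (complete (suc m) i j)))             ≡⟨ sum-cong {suc m} (complete-edge i) ⟩
  sumℚ {suc m} (λ j → 1ℚ - δ (toℕ i) (toℕ j))               ≡⟨ sum-- {suc m} (λ _ → 1ℚ) (λ j → δ (toℕ i) (toℕ j)) ⟩
  sumℚ {suc m} (λ _ → 1ℚ) - sumℚ {suc m} (λ j → δ (toℕ i) (toℕ j))
                                                            ≡⟨ cong₂ _-_ (sum-const (suc m) 1ℚ)
                                                                         (count-δ (suc m) (FinP.toℕ<n i)) ⟩
  N m * 1ℚ - 1ℚ                                             ≡⟨ cong (_- 1ℚ) (ℚP.*-identityʳ (N m)) ⟩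
  N m - 1ℚ                                                  ∎
  where open ≡-Reasoning

complete-laplacian : ∀ m (i k : Fin (suc m)) →
                     toℚ (laplacian (complete (suc m)) i k) ≡ N m * δ (toℕ i) (toℕ k) - 1ℚ
complete-laplacian m i k with i Fin.≟ k
... | yes refl = begin
  toℚ (degree (complete (suc m)) i)                         ≡⟨ complete-degree m i ⟩
  N m - 1ℚ                                                  ≡⟨ cong (_- 1ℚ) (sym (ℚP.*-identityʳ (N m))) ⟩
  N m * 1ℚ - 1ℚ                                             ≡⟨ cong (λ e → N m * e - 1ℚ) (sym (δ-diag (toℕ i))) ⟩
  N m * δ (toℕ i) (toℕ i) - 1ℚ                              ∎
  where open ≡-Reasoning
... | no  i≢k  = begin
  toℚ (ℤ.- b2ℤ (complete (suc m) i k))                      ≡⟨ toℚ-neg (b2ℤ (complete (suc m) i k)) ⟩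
  - toℚ (b2ℤ (complete (suc m) i k))                        ≡⟨ cong -_ (complete-edge i k) ⟩
  - (1ℚ - δ (toℕ i) (toℕ k))                                ≡⟨ cong (λ e → - (1ℚ - e)) i≠k ⟩
  - (1ℚ - 0ℚ)                                               ≡⟨ solve 1 (λ n → :- (con 1ℚ :- con 0ℚ) := n :* con 0ℚ :- con 1ℚ)
                                                                       refl (N m) ⟩
  N m * 0ℚ - 1ℚ                                             ≡⟨ cong (λ e → N m * e - 1ℚ) (sym i≠k) ⟩
  N m * δ (toℕ i) (toℕ k) - 1ℚ                              ∎
  where
  open ≡-Reasoning
  i≠k : δ (toℕ i) (toℕ k) ≡ 0ℚ
  i≠k = δ-off-diag (i≢k ∘ FinP.toℕ-injective)

matA-entry : ∀ m (k : Fin (suc m)) (c : Fin m) → toℚ (matA m k c) ≡ indLe (toℕ k) (toℕ c)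
matA-entry m k c with toℕ k ℕ.≤? toℕ c
... | yes k≤c = sym (indLe-yes k≤c)
... | no  k≰c = sym (indLe-no k≰c)

-- Vᵢ c = Σ_k (N·[i = k] − 1)·[k ≤ c] = N·[i ≤ c] − (c + 1)
V-entry : ∀ m i c → V m i c ≡ N m * indLe (toℕ i) (toℕ c) - toℚ (ℤ.+ suc (toℕ c))
V-entry m i c = begin
  toℚ (sumℤ (λ k → L i k ℤ.* matA m k c))                   ≡⟨ toℚ-sum (λ k → L i k ℤ.* matA m k c) ⟩
  sumℚ (λ k → toℚ (L i k ℤ.* matA m k c))                   ≡⟨ sum-cong entry ⟩
  sumℚ (λ k → N m * (δᵢ k * ι k) - ι k)                     ≡⟨ sum-- (λ k → N m * (δᵢ k * ι k)) ι ⟩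
  sumℚ (λ k → N m * (δᵢ k * ι k)) - sumℚ ι                  ≡⟨ cong (_- sumℚ ι) (sum-*ˡ (N m) (λ k → δᵢ k * ι k)) ⟩
  N m * sumℚ (λ k → δᵢ k * ι k) - sumℚ ι                    ≡⟨ cong₂ (λ a b → N m * a - b) (sum-δ-at i ι)
                                                                     (count-indLe (suc m) (toℕ c) c<1+m) ⟩
  N m * indLe (toℕ i) (toℕ c) - toℚ (ℤ.+ suc (toℕ c))       ∎
  where
  open ≡-Reasoning
  L = laplacian (complete (suc m))
  δᵢ ι : Fin (suc m) → ℚ
  δᵢ k = δ (toℕ i) (toℕ k)
  ι  k = indLe (toℕ k) (toℕ c)
  c<1+m : toℕ c ℕ.< suc m
  c<1+m = ℕP.m≤n⇒m≤1+n (FinP.toℕ<n c)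
  entry : ∀ k → toℚ (L i k ℤ.* matA m k c) ≡ N m * (δᵢ k * ι k) - ι k
  entry k = begin
    toℚ (L i k ℤ.* matA m k c)                              ≡⟨ toℚ-* (L i k) (matA m k c) ⟩
    toℚ (L i k) * toℚ (matA m k c)                          ≡⟨ cong₂ _*_ (complete-laplacian m i k) (matA-entry m k c) ⟩
    (N m * δᵢ k - 1ℚ) * ι k                                 ≡⟨ solve 3 (λ n e l → (n :* e :- con 1ℚ) :* l := n :* (e :* l) :- l)
                                                                     refl (N m) (δᵢ k) (ι k) ⟩
    N m * (δᵢ k * ι k) - ι k                                ∎

W-entry : ∀ m k c → W m k c ≡ δ (toℕ k) (suc (toℕ c)) - δ (toℕ k) (toℕ c)
W-entry m k c = trans (toℚ-+ (δℤ (toℕ k) (suc (toℕ c))) (ℤ.- δℤ (toℕ k) (toℕ c)))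
                      (cong (δ (toℕ k) (suc (toℕ c)) +_) (toℚ-neg (δℤ (toℕ k) (toℕ c))))

-- ⟨W_k, y⟩ = y_{k−1} − y_k, read through the zero-padded vector.
W-dot : ∀ m k (y : Point m) → dot (W m k) y ≡ padded y (toℕ k) - padded y (suc (toℕ k))
W-dot m k y = begin
  sumℚ (λ c → W m k c * y c)                                ≡⟨ sum-cong entry ⟩
  sumℚ (λ c → δ⁺ c * y c - δ⁰ c * y c)                      ≡⟨ sum-- (λ c → δ⁺ c * y c) (λ c → δ⁰ c * y c) ⟩
  sumℚ (λ c → δ⁺ c * y c) - sumℚ (λ c → δ⁰ c * y c)         ≡⟨ cong₂ _-_ (sum-δ-shift (toℕ k) y) (sum-δ (toℕ k) y) ⟩
  padded y (toℕ k) - padded y (suc (toℕ k))                 ∎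
  where
  open ≡-Reasoning
  δ⁺ δ⁰ : Fin m → ℚ
  δ⁺ c = δ (toℕ k) (suc (toℕ c))
  δ⁰ c = δ (toℕ k) (toℕ c)
  entry : ∀ c → W m k c * y c ≡ δ⁺ c * y c - δ⁰ c * y c
  entry c = trans (cong (_* y c) (W-entry m k c))
                  (solve 3 (λ a b v → (a :- b) :* v := a :* v :- b :* v) refl (δ⁺ c) (δ⁰ c) (y c))

profile : ∀ m → ℕ → ℕ → ℚ
profile m a p = N m * indLe (suc a) p - toℚ (ℤ.+ p)

V-padded : ∀ m (i : Fin (suc m)) {p} → p ℕ.≤ suc m → padded (V m i) p ≡ profile m (toℕ i) p
V-padded m i = padded-formula (V m i) (profile m (toℕ i)) (V-entry m i) at-0 at-top
  where
  at-0 : profile m (toℕ i) 0 ≡ 0ℚ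
  at-0 = cong (_- 0ℚ) (ℚP.*-zeroʳ (N m))
  at-top : profile m (toℕ i) (suc m) ≡ 0ℚ
  at-top = trans (cong (λ e → N m * e - N m) (indLe-yes (ℕP.≤-pred (FinP.toℕ<n i))))
                 (trans (cong (_- N m) (ℚP.*-identityʳ (N m))) (ℚP.+-inverseʳ (N m)))

-- Σ_k V_k c = N·(c + 1) − (m + 1)·(c + 1) = 0
complete-V-centred : ∀ m c → sumℚ (λ k → V m k c) ≡ 0ℚ
complete-V-centred m c = begin
  sumℚ (λ k → V m k c)                                      ≡⟨ sum-cong (λ k → V-entry m k c) ⟩
  sumℚ (λ k → N m * ι k - T)                                ≡⟨ sum-- (λ k → N m * ι k) (λ _ → T) ⟩
  sumℚ (λ k → N m * ι k) - sumℚ {suc m} (λ _ → T)           ≡⟨ cong₂ _-_ (sum-*ˡ (N m) ι) (sum-const (suc m) T) ⟩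
  N m * sumℚ ι - N m * T                                    ≡⟨ cong (λ z → N m * z - N m * T)
                                                                    (count-indLe (suc m) (toℕ c) (ℕP.m≤n⇒m≤1+n (FinP.toℕ<n c))) ⟩
  N m * T - N m * T                                         ≡⟨ ℚP.+-inverseʳ (N m * T) ⟩
  0ℚ                                                        ∎
  where
  open ≡-Reasoning
  T = toℚ (ℤ.+ suc (toℕ c))
  ι : Fin (suc m) → ℚ
  ι k = indLe (toℕ k) (toℕ c)

complete-W-centred : ∀ m c → sumℚ (λ k → W m k c) ≡ 0ℚ
complete-W-centred m c = begin
  sumℚ (λ k → W m k c)                                      ≡⟨ sum-cong entry ⟩
  sumℚ (λ k → δ⁺ k - δ⁰ k)                                  ≡⟨ sum-- δ⁺ δ⁰ ⟩
  sumℚ δ⁺ - sumℚ δ⁰                                         ≡⟨ cong₂ _-_ (count-δ (suc m) (s≤s (FinP.toℕ<n c)))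
                                                                         (count-δ (suc m) (ℕP.m≤n⇒m≤1+n (FinP.toℕ<n c))) ⟩
  1ℚ - 1ℚ                                                   ≡⟨ ℚP.+-inverseʳ 1ℚ ⟩
  0ℚ                                                        ∎
  where
  open ≡-Reasoning
  δ⁺ δ⁰ : Fin (suc m) → ℚ
  δ⁺ k = δ (suc (toℕ c)) (toℕ k)
  δ⁰ k = δ (toℕ c) (toℕ k)
  entry : ∀ k → W m k c ≡ δ⁺ k - δ⁰ k
  entry k = trans (W-entry m k c) (cong₂ _-_ (δ-sym (toℕ k) (suc (toℕ c))) (δ-sym (toℕ k) (toℕ c)))

-- ⟨Vᵢ, W_k⟩ = profile(k) − profile(k + 1) = 1 − N·[i = k]
complete-pairing : ∀ m i k → dot (V m i) (W m k) ≡ 1ℚ - N m * δ (toℕ i) (toℕ k)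
complete-pairing m i k = begin
  dot (V m i) (W m k)                                       ≡⟨ dot-comm (V m i) (W m k) ⟩
  dot (W m k) (V m i)                                       ≡⟨ W-dot m k (V m i) ⟩
  padded (V m i) b - padded (V m i) (suc b)                 ≡⟨ cong₂ _-_ (V-padded m i (ℕP.m≤n⇒m≤1+n b≤m))
                                                                         (V-padded m i (s≤s b≤m)) ⟩
  (N m * indLe (suc a) b - toℚ (ℤ.+ b)) - (N m * indLe a b - toℚ (ℤ.+ suc b))
                                                            ≡⟨ cong₂ (λ e t → (N m * indLe (suc a) b - toℚ (ℤ.+ b)) - (N m * e - t))
                                                                     (indLe-split a b) (toℚ-+ (ℤ.+ 1) (ℤ.+ b)) ⟩
  (N m * indLe (suc a) b - toℚ (ℤ.+ b)) - (N m * (δ a b + indLe (suc a) b) - (1ℚ + toℚ (ℤ.+ b)))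
                                                            ≡⟨ telescope (N m) (indLe (suc a) b) (δ a b) (toℚ (ℤ.+ b)) ⟩
  1ℚ - N m * δ a b                                          ∎
  where
  open ≡-Reasoning
  a = toℕ i
  b = toℕ k
  b≤m : b ℕ.≤ m
  b≤m = ℕP.≤-pred (FinP.toℕ<n k)
  telescope : ∀ n l e t → (n * l - t) - (n * (e + l) - (1ℚ + t)) ≡ 1ℚ - n * e
  telescope = solve 4 (λ n l e t → (n :* l :- t) :- (n :* (e :+ l) :- (con 1ℚ :+ t)) := con 1ℚ :- n :* e) refl

-- Σ_k V_k c · W_k d = V_{d+1} c − V_d c = −N·[d = c]
complete-resolution : ∀ m c d → combo (λ k → V m k c) (W m) d ≡ - (N m * δ (toℕ c) (toℕ d))
complete-resolution m c d = begin
  sumℚ (λ k → V m k c * W m k d)                            ≡⟨ sum-cong entry ⟩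
  sumℚ (λ k → δ⁺ k * column k - δ⁰ k * column k)            ≡⟨ sum-- (λ k → δ⁺ k * column k) (λ k → δ⁰ k * column k) ⟩
  sumℚ (λ k → δ⁺ k * column k) - sumℚ (λ k → δ⁰ k * column k)
                                                            ≡⟨ cong₂ _-_ (trans (sum-δ (suc (toℕ d)) column) (column-at (s≤s d<m)))
                                                                         (trans (sum-δ (toℕ d) column) (column-at (ℕP.m≤n⇒m≤1+n d<m))) ⟩
  (N m * indLe (suc (toℕ d)) (toℕ c) - T) - (N m * indLe (toℕ d) (toℕ c) - T)
                                                            ≡⟨ cong (λ e → (N m * indLe (suc (toℕ d)) (toℕ c) - T) - (N m * e - T))
                                                                    (indLe-split (toℕ d) (toℕ c)) ⟩
  (N m * indLe (suc (toℕ d)) (toℕ c) - T) - (N m * (δ (toℕ d) (toℕ c) + indLe (suc (toℕ d)) (toℕ c)) - T)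
                                                            ≡⟨ difference (N m) (indLe (suc (toℕ d)) (toℕ c)) (δ (toℕ d) (toℕ c)) T ⟩
  - (N m * δ (toℕ d) (toℕ c))                               ≡⟨ cong (λ e → - (N m * e)) (δ-sym (toℕ d) (toℕ c)) ⟩
  - (N m * δ (toℕ c) (toℕ d))                               ∎
  where
  open ≡-Reasoning
  T = toℚ (ℤ.+ suc (toℕ c))
  d<m = FinP.toℕ<n d
  column δ⁺ δ⁰ : Fin (suc m) → ℚ
  column k = V m k c
  δ⁺ k = δ (suc (toℕ d)) (toℕ k)
  δ⁰ k = δ (toℕ d) (toℕ k)
  column-at : ∀ {a} → a ℕ.< suc m → entryAt column a ≡ N m * indLe a (toℕ c) - T
  column-at = entryAt-formula column (λ a → N m * indLe a (toℕ c) - T) (λ k → V-entry m k c)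
  entry : ∀ k → V m k c * W m k d ≡ δ⁺ k * column k - δ⁰ k * column k
  entry k = trans (cong (column k *_) (trans (W-entry m k d)
                                             (cong₂ _-_ (δ-sym (toℕ k) (suc (toℕ d))) (δ-sym (toℕ k) (toℕ d)))))
                  (solve 3 (λ v a b → v :* (a :- b) := a :* v :- b :* v) refl (column k) (δ⁺ k) (δ⁰ k))
  difference : ∀ n l e t → (n * l - t) - (n * (e + l) - t) ≡ - (n * e)
  difference = solve 4 (λ n l e t → (n :* l :- t) :- (n :* (e :+ l) :- t) := :- (n :* e)) refl

complete-dual : ∀ m → DualSimplices m (V m) (W m)
complete-dual m = record
  { V-centred  = complete-V-centred m
  ; W-centred  = complete-W-centred m
  ; pairing    = complete-pairing m
  ; resolution = complete-resolution m
  }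

p≤∣p∣ : ∀ p → p ≤ ∣ p ∣
p≤∣p∣ (mkℚ (ℤ.+ n)   _ _) = ℚP.≤-refl
p≤∣p∣ (mkℚ -[1+ n ] _ _) = ℚ.*≤* ℤ.-≤+

W-bounded : ∀ m (x : Point m) → (∀ c → ∣ x c ∣ ≤ ½) → ∀ k → dot (W m k) x ≤ 1ℚ
W-bounded m x x≤½ k = begin
  dot (W m k) x                     ≡⟨ W-dot m k x ⟩
  x₋ - x₀                           ≤⟨ p≤∣p∣ (x₋ - x₀) ⟩
  ∣ x₋ - x₀ ∣                       ≤⟨ ℚP.∣p-q∣≤∣p∣+∣q∣ x₋ x₀ ⟩
  ∣ x₋ ∣ + ∣ x₀ ∣                   ≤⟨ ℚP.+-mono-≤ (padded-bound x 0≤½ x≤½ (toℕ k)) (padded-bound x 0≤½ x≤½ (suc (toℕ k))) ⟩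
  ½ + ½                             ≡⟨⟩
  1ℚ                                ∎
  where
  open ℚP.≤-Reasoning
  x₋ = padded x (toℕ k)
  x₀ = padded x (suc (toℕ k))
  0≤½ : 0ℚ ≤ ½
  0≤½ = ℚP.nonNegative⁻¹ ½

theorem6p1 : (m : ℕ) → IsReflexive (laplacianSimplexVertices (complete (suc m)))
theorem6p1 m =
  (½ , ℚP.positive⁻¹ ½ , λ x x≤½ → in-hull (complete-dual m) x (W-bounded m x x≤½)) ,
  (suc m , Wℤ m , dual-is-hull (complete-dual m))
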